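{- Let $\lambda$ be a partition with distinct parts. Then there exists a minimal bar tableau $T^*$ of shape $\lambda$ such that no bar boundary lies an even number of squares along any row; that is, for every row $i$ of $S(\lambda)$ and every $k$ with $1\le k<\lambda_i$, if the $k$-th and $(k+1)$-st squares (counted from the left) of row $i$ carry different labels in $T^*$, then $k$ is odd.
   Context: For a partition $\lambda$ with distinct parts of length $\ell$, the shifted diagram $S(\lambda)$ has $\ell$ rows, row $i$ consisting of $\lambda_i$ squares, the first square of row $i$ (for $i>1$) placed under the second square of row $i-1$. For an odd positive integer $r$ (put $\lambda_{\ell+1}=0$), the $r$-bars of $\lambda$ are: (type 1) for a row $i$ such that $\lambda_{j+1}<\lambda_i-r<\lambda_j$ for some $j\le \ell$, the rightmost $r$ squares of row $i$; removing them gives the strict partition obtained by deleting $\lambda_i$ and inserting $\lambda_i-r$ in its sorted position; (type 2) for a row $i$ with $\lambda_i=r$, the whole row $i$; removing it deletes the part $\lambda_i$; (type 3) for rows $i<j$ with $\lambda_i+\lambda_j=r$, all squares of rows $i$ and $j$; removing it deletes both parts. A bar tableau of shape $\lambda$ is an assignment of positive integers to the squares of $S(\lambda)$ such that either $\lambda$ is empty, or the set of squares carrying the largest integer is an $r$-bar (for some odd $r$) and, after removing this bar and reordering the remaining rows so that they form the shifted diagram of the resulting strict partition (a shortened row keeping its remaining leftmost entries), the result is a bar tableau. Each label occupies exactly one bar; the number of bars is the number of distinct labels. A bar tableau of shape $\lambda$ is minimal if no bar tableau of shape $\lambda$ has fewer bars. -}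

module Defs where

open import Data.Nat using (ℕ; zero; suc; _+_; _*_; _<_; _≤_; _<ᵇ_; _⊔_)
open import Data.Nat.Properties using (_≟_)
open import Data.List using (List; []; _∷_; _++_; length; map; concat; replicate; foldr; deduplicate)
open import Data.List.Membership.Propositional using (_∈_; _∉_)
open import Data.List.Relation.Unary.All using (All)
open import Data.List.Relation.Unary.Linked using (Linked)
open import Data.Product using (Σ; ∃; _×_)
open import Data.Bool using (if_then_else_)
open import Relation.Binary.PropositionalEquality using (_≡_; _≢_)

Odd : ℕ → Set
Odd n = ∃ λ k → n ≡ suc (2 * k)

StrictPartition : List ℕ → Set
StrictPartition λs = All (0 <_) λs × Linked (λ a b → b < a) λs

-- A filling of the shifted diagram: the list of rows (top to bottom),
-- each row the list of its labels from left to right.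
-- (Shifting the rows does not affect any of the notions involved.)
Tableau : Set
Tableau = List (List ℕ)

shape : Tableau → List ℕ
shape = map length

labels : Tableau → List ℕ
labels = concat

maxLabel : Tableau → ℕ
maxLabel T = foldr _⊔_ 0 (labels T)

NoLabel : ℕ → List ℕ → Set
NoLabel m row = m ∉ row

insertRow : List ℕ → Tableau → Tableau
insertRow p [] = p ∷ []
insertRow p (q ∷ qs) = if length q <ᵇ length p then p ∷ q ∷ qs else q ∷ insertRow p qs

-- bar tableaux: the squares carrying the largest label form an r-bar (r odd);
-- removing it (and reordering rows) leaves a bar tableau.
data IsBarTableau : Tableau → Set where
  empty : IsBarTableau []
  -- type 1: the rightmost r squares of row i (r odd); the remaining row length
  -- is positive and differs from all other parts (λ_{j+1} < λ_i - r < λ_j)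
  bar1 : ∀ (A B : Tableau) (p : List ℕ) (r m : ℕ) →
         m ≡ maxLabel (A ++ (p ++ replicate r m) ∷ B) →
         Odd r → 0 < length p → NoLabel m p →
         All (NoLabel m) A → All (NoLabel m) B →
         length p ∉ shape (A ++ B) →
         IsBarTableau (insertRow p (A ++ B)) →
         IsBarTableau (A ++ (p ++ replicate r m) ∷ B)
  -- type 2: a whole row of odd length r
  bar2 : ∀ (A B : Tableau) (r m : ℕ) →
         m ≡ maxLabel (A ++ replicate r m ∷ B) →
         Odd r →
         All (NoLabel m) A → All (NoLabel m) B →
         IsBarTableau (A ++ B) →
         IsBarTableau (A ++ replicate r m ∷ B)
  -- type 3: two whole rows i < j with λ_i + λ_j = r odd
  bar3 : ∀ (A B C : Tableau) (r₁ r₂ m : ℕ) →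
         m ≡ maxLabel (A ++ replicate r₁ m ∷ B ++ replicate r₂ m ∷ C) →
         Odd (r₁ + r₂) → 0 < r₁ → 0 < r₂ →
         All (NoLabel m) A → All (NoLabel m) B → All (NoLabel m) C →
         IsBarTableau (A ++ B ++ C) →
         IsBarTableau (A ++ replicate r₁ m ∷ B ++ replicate r₂ m ∷ C)

BarTableauOfShape : List ℕ → Tableau → Set
BarTableauOfShape λs T = shape T ≡ λs × All (All (0 <_)) T × IsBarTableau T

-- number of bars = number of distinct labels
numBars : Tableau → ℕ
numBars T = length (deduplicate _≟_ (labels T))

MinimalBarTableau : List ℕ → Tableau → Set
MinimalBarTableau λs T =
  BarTableauOfShape λs T × (∀ T′ → BarTableauOfShape λs T′ → numBars T ≤ numBars T′)

OddBoundaries : Tableau → Set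
OddBoundaries T = ∀ row → row ∈ T →
  ∀ (xs ys : List ℕ) (a b : ℕ) → row ≡ xs ++ a ∷ b ∷ ys → a ≢ b → Odd (suc (length xs))

{-# OPTIONS --safe #-}
module Submission where

-- Let o and e count the odd and even parts of a shape. Removing a bar of type 2
-- deletes an odd part, one of type 3 an odd and an even part, and one of type 1
-- changes the parity of one part. So every removal changes o by exactly one and e
-- by at most one, and a bar tableau with n bars has n ≥ o, n ≥ e and n ≡ o (mod 2).
-- The least such n is attained: pair an odd with an even part into a type-3 bar
-- while both kinds remain, remove the remaining odd parts as type-2 bars, and when
-- only even parts remain split the last square off the largest one as a 1-bar,
-- which leaves an odd part. Each row of this tableau is constant, or constant of odd
-- length followed by one more square, so labels change only after an odd number of
-- squares.

open import Defs
open import Data.Bool using (Bool; true; false; not; _xor_)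
open import Data.Bool.Properties using (not-involutive; not-injective; not-distribˡ-xor; xor-same)
import Data.Bool.Properties as Bool
open import Data.Empty using (⊥-elim)
open import Data.List using (List; []; _∷_; _++_; _∷ʳ_; [_]; length; map; replicate; foldr; filterᵇ; deduplicate; initLast; _∷ʳ′_)
open import Data.List.Properties using (∷-injective; length-replicate; length-++; map-++; ++-assoc; foldr-++; ∷ʳ-injectiveˡ; ∷ʳ-++)
open import Data.List.Membership.Propositional using (_∈_; _∉_; find)
open import Data.List.Membership.Propositional.Properties using (∈-++⁺ʳ; ∈-++⁻; ∈-concat⁺′; ∈-concat⁻′; ∈-∃++; ∈-deduplicate⁻; ∈-deduplicate⁺)
open import Data.List.Membership.Propositional.Properties.WithK using (unique∧set⇒bag)
open import Data.List.Relation.Binary.BagAndSetEquality using (_∼[_]_; set; [_]-Equality; ∷-cong; bag-=⇒; concat-cong; ↭⇒∼bag; ∼bag⇒↭)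
open import Data.List.Relation.Binary.Permutation.Propositional using (_↭_; ↭-refl; ↭-sym; ↭-trans; ↭-reflexive; ↭-prep; ↭-swap; ↭⇒↭ₛ; module PermutationReasoning)
open import Data.List.Relation.Binary.Permutation.Propositional.Properties using (shift; shifts; ++⁺ˡ; map⁺; ↭-length; filter-↭; All-resp-↭)
open import Data.List.Relation.Binary.Permutation.Setoid.Properties using (foldr-commMonoid)
open import Data.List.Relation.Unary.All as All using (All; []; _∷_; all?)
open import Data.List.Relation.Unary.All.Properties using (++⁺; ++⁻ˡ; ++⁻ʳ; replicate⁺; ¬Any⇒All¬; ¬All⇒Any¬)
open import Data.List.Relation.Unary.AllPairs using (_∷_)
open import Data.List.Relation.Unary.Any using (here; there)
open import Data.List.Relation.Unary.Linked as Linked using (Linked; []; [-]; _∷_)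
open import Data.List.Relation.Unary.Unique.Propositional using (Unique)
open import Data.Nat using (ℕ; zero; suc; _+_; _*_; _<_; _>_; _≤_; _<ᵇ_; _⊔_; z≤n; s≤s; s≤s⁻¹)
open import Data.Nat.Induction using (<-wellFounded)
open import Data.Nat.ListAction using (sum)
open import Data.Nat.Properties
open import Data.List.Relation.Unary.Unique.DecPropositional.Properties _≟_ using (deduplicate-!)
open import Data.Product using (∃; ∃₂; _×_; _,_; proj₂)
open import Data.Sum using (_⊎_; inj₁; inj₂)
open import Function using (_∘_)
open import Function.Bundles using (mk⇔)
open import Induction.WellFounded using (Acc; acc)
open import Level using (Level)
open import Relation.Binary using (Rel; Transitive; Setoid)
open import Relation.Binary.PropositionalEquality hiding ([_])
open import Relation.Nullary using (yes; no)

private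
  variable
    a ℓ : Level
    X : Set a
    k n o e x y : ℕ
    λs μs : List ℕ

isOdd : ℕ → Bool
isOdd zero    = false
isOdd (suc n) = not (isOdd n)

isOdd-+ : ∀ m n → isOdd (m + n) ≡ isOdd m xor isOdd n
isOdd-+ zero    n = refl
isOdd-+ (suc m) n = trans (cong not (isOdd-+ m n)) (not-distribˡ-xor (isOdd m) (isOdd n))

isOdd-double : ∀ k → isOdd (2 * k) ≡ false
isOdd-double k = begin
  isOdd (k + (k + 0))        ≡⟨ isOdd-+ k (k + 0) ⟩
  isOdd k xor isOdd (k + 0)  ≡⟨ cong (λ j → isOdd k xor isOdd j) (+-identityʳ k) ⟩
  isOdd k xor isOdd k        ≡⟨ xor-same (isOdd k) ⟩
  false                      ∎
  where open ≡-Reasoning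

Odd⇒isOdd : Odd n → isOdd n ≡ true
Odd⇒isOdd (k , refl) = cong not (isOdd-double k)

isOdd⇒Odd : ∀ n → isOdd n ≡ true → Odd n
isOdd⇒Odd zero          ()
isOdd⇒Odd (suc zero)    _ = 0 , refl
isOdd⇒Odd (suc (suc n)) odd
  with k , refl ← isOdd⇒Odd n (trans (sym (not-involutive (isOdd n))) odd)
  = suc k , cong suc (sym (*-suc 2 k))

isOdd⇒0< : isOdd n ≡ true → 0 < n
isOdd⇒0< {suc n} _ = s≤s z≤n

isOdd-+-≢ : ∀ m n → isOdd m ≢ isOdd n → isOdd (m + n) ≡ true
isOdd-+-≢ m n m≢n rewrite isOdd-+ m n with isOdd m | isOdd n
... | true  | true  = ⊥-elim (m≢n refl)
... | true  | false = refl
... | false | true  = refl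
... | false | false = ⊥-elim (m≢n refl)

oddParts evenParts : List ℕ → ℕ
oddParts  = length ∘ filterᵇ isOdd
evenParts = length ∘ filterᵇ (not ∘ isOdd)

oddParts-↭ : λs ↭ μs → oddParts λs ≡ oddParts μs
oddParts-↭ = ↭-length ∘ filter-↭ _

evenParts-↭ : λs ↭ μs → evenParts λs ≡ evenParts μs
evenParts-↭ = ↭-length ∘ filter-↭ _

evenParts-allOdd : All (λ z → isOdd z ≡ true) λs → evenParts λs ≡ 0
evenParts-allOdd []             = refl
evenParts-allOdd (odd ∷ odds) rewrite odd = evenParts-allOdd odds

oddParts-allEven : All (λ z → isOdd z ≡ false) λs → oddParts λs ≡ 0
oddParts-allEven []               = refl
oddParts-allEven (even ∷ evens) rewrite even = oddParts-allEven evens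

-- The minimal number of bars

-- The least n with n ≥ o, n ≥ e and n ≡ o (mod 2).
minBars : ℕ → ℕ → ℕ
minBars o       zero    = o
minBars zero    (suc e) = suc (minBars 1 e)
minBars (suc o) (suc e) = suc (minBars o e)

minBars-least : e ≤ n → o ≤ n → isOdd n ≡ isOdd o → minBars o e ≤ n
minBars-least {zero}                        _         o≤n       _   = o≤n
minBars-least {suc e} {suc (suc n)} {zero}  (s≤s e≤n) _         par =
  s≤s (minBars-least e≤n (s≤s z≤n) (not-injective par))
minBars-least {suc e} {suc zero}    {zero}  _         _         ()
minBars-least {suc e} {suc n}       {suc o} (s≤s e≤n) (s≤s o≤n) par =
  s≤s (minBars-least e≤n o≤n (not-injective par))

minBarsOf : List ℕ → ℕ
minBarsOf λs = minBars (oddParts λs) (evenParts λs)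

minBarsOf-↭ : λs ↭ μs → minBarsOf λs ≡ minBarsOf μs
minBarsOf-↭ p = cong₂ minBars (oddParts-↭ p) (evenParts-↭ p)

minBarsOf-∷-odd : ∀ x λs → isOdd x ≡ true → All (λ z → isOdd z ≡ true) λs →
                  minBarsOf (x ∷ λs) ≡ suc (minBarsOf λs)
minBarsOf-∷-odd x λs x-odd odds rewrite x-odd | evenParts-allOdd odds = refl

minBarsOf-∷-pair : ∀ x y λs → isOdd (x + y) ≡ true → minBarsOf (x ∷ y ∷ λs) ≡ suc (minBarsOf λs)
minBarsOf-∷-pair x y λs odd rewrite isOdd-+ x y with isOdd x | isOdd y in ey | odd
... | true  | false | _ rewrite ey = refl
... | false | true  | _ rewrite ey = refl

minBarsOf-suc : ∀ x λs → isOdd x ≡ true → All (λ z → isOdd z ≡ false) λs →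
                minBarsOf (suc x ∷ λs) ≡ suc (minBarsOf (x ∷ λs))
minBarsOf-suc x λs x-odd evens rewrite x-odd | oddParts-allEven evens = refl

Feasible : ℕ → List ℕ → Set
Feasible n λs = evenParts λs ≤ n × oddParts λs ≤ n × isOdd n ≡ isOdd (oddParts λs)

Feasible-resp : k ≡ n → λs ↭ μs → Feasible k λs → Feasible n μs
Feasible-resp {k} refl p (e≤k , o≤k , par) =
  subst (_≤ k) (evenParts-↭ p) e≤k , subst (_≤ k) (oddParts-↭ p) o≤k ,
  trans par (cong isOdd (oddParts-↭ p))

Feasible-∷-odd : ∀ x λs → Odd x → Feasible n λs → Feasible (suc n) (x ∷ λs)
Feasible-∷-odd x λs x-odd (e≤n , o≤n , par) rewrite Odd⇒isOdd x-odd =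
  m≤n⇒m≤1+n e≤n , s≤s o≤n , cong not par

Feasible-∷-pair : ∀ x y λs → isOdd (x + y) ≡ true → Feasible n λs → Feasible (suc n) (x ∷ y ∷ λs)
Feasible-∷-pair x y λs odd (e≤n , o≤n , par) rewrite isOdd-+ x y with isOdd x | isOdd y in ey | odd
... | true  | false | _ rewrite ey = s≤s e≤n , s≤s o≤n , cong not par
... | false | true  | _ rewrite ey = s≤s e≤n , s≤s o≤n , cong not par

Feasible-+-odd : ∀ x r λs → Odd r → Feasible n (x ∷ λs) → Feasible (suc n) (x + r ∷ λs)
Feasible-+-odd x r λs r-odd f rewrite isOdd-+ x r | Odd⇒isOdd r-odd with isOdd x | f
... | true  | e≤n , o<n , par =
  s≤s e≤n , m≤n⇒m≤1+n (<⇒≤ o<n) , trans (cong not par) (not-involutive _)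
... | false | e<n , o≤n , par =
  m≤n⇒m≤1+n (<⇒≤ e<n) , s≤s o≤n , cong not par

module ∼set = Setoid ([ set ]-Equality ℕ)

distinct : List ℕ → ℕ
distinct xs = length (deduplicate _≟_ xs)

unique∧set⇒length≡ : {xs ys : List ℕ} → Unique xs → Unique ys → xs ∼[ set ] ys →
                     length xs ≡ length ys
unique∧set⇒length≡ xs! ys! xs≈ys = ↭-length (∼bag⇒↭ (unique∧set⇒bag xs! ys! xs≈ys))

deduplicate-∼set : (xs : List ℕ) → deduplicate _≟_ xs ∼[ set ] xs
deduplicate-∼set xs = mk⇔ (∈-deduplicate⁻ _≟_ xs) (∈-deduplicate⁺ _≟_)

distinct-cong : {xs ys : List ℕ} → xs ∼[ set ] ys → distinct xs ≡ distinct ys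
distinct-cong {xs} {ys} xs≈ys = unique∧set⇒length≡ (deduplicate-! xs) (deduplicate-! ys)
  (∼set.trans (deduplicate-∼set xs) (∼set.trans xs≈ys (∼set.sym (deduplicate-∼set ys))))

distinct-∷-fresh : ∀ {m xs} → m ∉ xs → distinct (m ∷ xs) ≡ suc (distinct xs)
distinct-∷-fresh {m} {xs} m∉xs = unique∧set⇒length≡ (deduplicate-! (m ∷ xs)) (m∉dedup ∷ deduplicate-! xs)
  (∼set.trans (deduplicate-∼set (m ∷ xs)) (∷-cong refl (∼set.sym (deduplicate-∼set xs))))
  where
  m∉dedup = ¬Any⇒All¬ _ (m∉xs ∘ ∈-deduplicate⁻ _≟_ xs)

replicate-++-∼set : ∀ s m (xs : List ℕ) → replicate (suc s) m ++ xs ∼[ set ] m ∷ xs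
replicate-++-∼set s m xs = mk⇔ to from
  where
  to : ∀ {z} → z ∈ replicate (suc s) m ++ xs → z ∈ m ∷ xs
  to z∈ with ∈-++⁻ (replicate (suc s) m) z∈
  ... | inj₁ z∈m* = here (All.lookup (replicate⁺ {P = _≡ m} (suc s) refl) z∈m*)
  ... | inj₂ z∈xs = there z∈xs
  from : ∀ {z} → z ∈ m ∷ xs → z ∈ replicate (suc s) m ++ xs
  from (here refl)  = here refl
  from (there z∈xs) = ∈-++⁺ʳ (replicate (suc s) m) z∈xs

∈⇒≤foldr-⊔ : ∀ {z xs} → z ∈ xs → z ≤ foldr _⊔_ 0 xs
∈⇒≤foldr-⊔ {xs = x ∷ xs} (here refl)  = m≤m⊔n x _
∈⇒≤foldr-⊔ {xs = x ∷ xs} (there z∈xs) = ≤-trans (∈⇒≤foldr-⊔ z∈xs) (m≤n⊔m x _)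

foldr-⊔-replicate : ∀ s m z → foldr _⊔_ z (replicate (suc s) m) ≡ m ⊔ z
foldr-⊔-replicate zero    m z = refl
foldr-⊔-replicate (suc s) m z = begin
  m ⊔ foldr _⊔_ z (replicate (suc s) m)  ≡⟨ cong (m ⊔_) (foldr-⊔-replicate s m z) ⟩
  m ⊔ (m ⊔ z)                            ≡⟨ ⊔-assoc m m z ⟨
  m ⊔ m ⊔ z                              ≡⟨ cong (_⊔ z) (⊔-idem m) ⟩
  m ⊔ z                                  ∎
  where open ≡-Reasoning

replicate-+ : ∀ m n (z : X) → replicate (m + n) z ≡ replicate m z ++ replicate n z
replicate-+ zero    n z = refl
replicate-+ (suc m) n z = cong (z ∷_) (replicate-+ m n z)

shift₂ : ∀ (u v : X) A B C → A ++ u ∷ B ++ v ∷ C ↭ u ∷ v ∷ A ++ B ++ C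
shift₂ u v A B C = begin
  A ++ u ∷ B ++ v ∷ C    ↭⟨ shift u A (B ++ v ∷ C) ⟩
  u ∷ A ++ B ++ v ∷ C    ≡⟨ cong (u ∷_) (++-assoc A B (v ∷ C)) ⟨
  u ∷ (A ++ B) ++ v ∷ C  ↭⟨ ↭-prep u (shift v (A ++ B) C) ⟩
  u ∷ v ∷ (A ++ B) ++ C  ≡⟨ cong (λ zs → u ∷ v ∷ zs) (++-assoc A B C) ⟩
  u ∷ v ∷ A ++ B ++ C    ∎
  where open PermutationReasoning

map-++⁻ : ∀ {Y : Set} (f : X → Y) xs {ys zs} → map f xs ≡ ys ++ zs →
          ∃₂ λ xs₁ xs₂ → xs ≡ xs₁ ++ xs₂ × map f xs₁ ≡ ys × map f xs₂ ≡ zs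
map-++⁻ f xs       {[]}          refl = [] , xs , refl , refl , refl
map-++⁻ f (x ∷ xs) {y ∷ ys} {zs} eq
  with refl , eq′ ← ∷-injective eq
  with xs₁ , xs₂ , refl , refl , refl ← map-++⁻ f xs {ys} {zs} eq′ = x ∷ xs₁ , xs₂ , refl , refl , refl

insertRow-↭ : ∀ p T → insertRow p T ↭ p ∷ T
insertRow-↭ p []      = ↭-refl
insertRow-↭ p (q ∷ T) with length q <ᵇ length p
... | true  = ↭-refl
... | false = ↭-trans (↭-prep q (insertRow-↭ p T)) (↭-swap q p ↭-refl)

insertRow-longest : ∀ p T → Linked _>_ (shape (p ∷ T)) → insertRow p T ≡ p ∷ T
insertRow-longest p []      _         = refl
insertRow-longest p (q ∷ T) (q<p ∷ _) with length q <ᵇ length p | <⇒<ᵇ q<p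
... | true | _ = refl

labels-↭ : ∀ {T T′} → T ↭ T′ → labels T ↭ labels T′
labels-↭ = ∼bag⇒↭ ∘ concat-cong ∘ ↭⇒∼bag

shape-↭ : ∀ {T T′} → T ↭ T′ → shape T ↭ shape T′
shape-↭ = map⁺ length

labels-bar1 : ∀ A B p r m →
              labels (A ++ (p ++ replicate r m) ∷ B) ↭ replicate r m ++ labels (insertRow p (A ++ B))
labels-bar1 A B p r m = begin
  labels (A ++ (p ++ replicate r m) ∷ B)          ↭⟨ labels-↭ (shift _ A B) ⟩
  (p ++ replicate r m) ++ labels (A ++ B)         ≡⟨ ++-assoc p _ _ ⟩
  p ++ replicate r m ++ labels (A ++ B)           ↭⟨ shifts p (replicate r m) ⟩
  replicate r m ++ labels (p ∷ A ++ B)            ↭⟨ ++⁺ˡ _ (labels-↭ (insertRow-↭ p (A ++ B))) ⟨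
  replicate r m ++ labels (insertRow p (A ++ B))  ∎
  where open PermutationReasoning

labels-bar2 : ∀ A B r m → labels (A ++ replicate r m ∷ B) ↭ replicate r m ++ labels (A ++ B)
labels-bar2 A B r m = labels-↭ (shift _ A B)

labels-bar3 : ∀ A B C r₁ r₂ m → labels (A ++ replicate r₁ m ∷ B ++ replicate r₂ m ∷ C)
                                 ↭ replicate (r₁ + r₂) m ++ labels (A ++ B ++ C)
labels-bar3 A B C r₁ r₂ m = begin
  labels (A ++ replicate r₁ m ∷ B ++ replicate r₂ m ∷ C)      ↭⟨ labels-↭ (shift₂ _ _ A B C) ⟩
  replicate r₁ m ++ replicate r₂ m ++ labels (A ++ B ++ C)    ≡⟨ ++-assoc (replicate r₁ m) _ _ ⟨
  (replicate r₁ m ++ replicate r₂ m) ++ labels (A ++ B ++ C)  ≡⟨ cong (_++ _) (replicate-+ r₁ r₂ m) ⟨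
  replicate (r₁ + r₂) m ++ labels (A ++ B ++ C)               ∎
  where open PermutationReasoning

shape-bar1 : ∀ A B p r m → shape (A ++ (p ++ replicate r m) ∷ B) ↭ length p + r ∷ shape (A ++ B)
shape-bar1 A B p r m = ↭-trans (shape-↭ (shift _ A B))
  (↭-reflexive (cong (_∷ shape (A ++ B)) (trans (length-++ p) (cong (length p +_) (length-replicate r)))))

shape-bar2 : ∀ A B r m → shape (A ++ replicate r m ∷ B) ↭ r ∷ shape (A ++ B)
shape-bar2 A B r m =
  ↭-trans (shape-↭ (shift _ A B)) (↭-reflexive (cong (_∷ shape (A ++ B)) (length-replicate r)))

shape-bar3 : ∀ A B C r₁ r₂ m → shape (A ++ replicate r₁ m ∷ B ++ replicate r₂ m ∷ C)
                                ↭ r₁ ∷ r₂ ∷ shape (A ++ B ++ C)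
shape-bar3 A B C r₁ r₂ m = ↭-trans (shape-↭ (shift₂ _ _ A B C))
  (↭-reflexive (cong₂ (λ ℓ₁ ℓ₂ → ℓ₁ ∷ ℓ₂ ∷ shape (A ++ B ++ C)) (length-replicate r₁) (length-replicate r₂)))

numBars-addBar : ∀ T T′ {m} s → m ∉ labels T′ → labels T ↭ replicate (suc s) m ++ labels T′ →
                 numBars T ≡ suc (numBars T′)
numBars-addBar T T′ {m} s m∉T′ T↭ = trans
  (distinct-cong (∼set.trans (bag-=⇒ (↭⇒∼bag T↭)) (replicate-++-∼set s m (labels T′))))
  (distinct-∷-fresh m∉T′)

maxLabel-addBar : ∀ T T′ {m} s → labels T ↭ replicate (suc s) m ++ labels T′ →
                  maxLabel T ≡ m ⊔ maxLabel T′
maxLabel-addBar T T′ {m} s T↭ = begin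
  foldr _⊔_ 0 (labels T)
    ≡⟨ foldr-commMonoid (setoid ℕ) ⊔-0-isCommutativeMonoid (↭⇒↭ₛ T↭) ⟩
  foldr _⊔_ 0 (replicate (suc s) m ++ labels T′)  ≡⟨ foldr-++ _⊔_ 0 (replicate (suc s) m) (labels T′) ⟩
  foldr _⊔_ (maxLabel T′) (replicate (suc s) m)   ≡⟨ foldr-⊔-replicate s m (maxLabel T′) ⟩
  m ⊔ maxLabel T′                                 ∎
  where open ≡-Reasoning

All-NoLabel⇒∉labels : ∀ {m T} → All (NoLabel m) T → m ∉ labels T
All-NoLabel⇒∉labels {T = T} none m∈T
  with row , m∈row , row∈T ← ∈-concat⁻′ T m∈T = All.lookup none row∈T m∈row

freshLabel : Tableau → ℕ
freshLabel T = suc (maxLabel T)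

freshLabel-NoLabel : ∀ T → All (NoLabel (freshLabel T)) T
freshLabel-NoLabel T = All.tabulate λ row∈T m∈row → 1+n≰n (∈⇒≤foldr-⊔ (∈-concat⁺′ m∈row row∈T))

freshLabel-max : ∀ T T′ s → labels T ↭ replicate (suc s) (freshLabel T′) ++ labels T′ →
                 freshLabel T′ ≡ maxLabel T
freshLabel-max T T′ s T↭ = sym (trans (maxLabel-addBar T T′ s T↭) (m≥n⇒m⊔n≡m (n≤1+n (maxLabel T′))))

freshLabel-numBars : ∀ T T′ s → labels T ↭ replicate (suc s) (freshLabel T′) ++ labels T′ →
                     numBars T ≡ suc (numBars T′)
freshLabel-numBars T T′ s = numBars-addBar T T′ s (All-NoLabel⇒∉labels (freshLabel-NoLabel T′))

-- Lower bound

numBars-feasible : ∀ {T} → IsBarTableau T → Feasible (numBars T) (shape T)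
numBars-feasible empty = z≤n , z≤n , refl
numBars-feasible (bar1 A B p r m _ r-odd@(k , refl) _ p∌m A∌m B∌m _ T′-bar) =
  Feasible-resp (sym (numBars-addBar T T′ (2 * k) m∉T′ (labels-bar1 A B p r m))) (↭-sym (shape-bar1 A B p r m))
    (Feasible-+-odd (length p) r (shape (A ++ B)) r-odd
      (Feasible-resp refl (shape-↭ (insertRow-↭ p (A ++ B))) (numBars-feasible T′-bar)))
  where
  T = A ++ (p ++ replicate r m) ∷ B
  T′ = insertRow p (A ++ B)
  m∉T′ = All-NoLabel⇒∉labels (All-resp-↭ (↭-sym (insertRow-↭ p (A ++ B))) (p∌m ∷ ++⁺ A∌m B∌m))
numBars-feasible (bar2 A B r m _ r-odd@(k , refl) A∌m B∌m T′-bar) =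
  Feasible-resp (sym (numBars-addBar T (A ++ B) (2 * k) m∉T′ (labels-bar2 A B r m))) (↭-sym (shape-bar2 A B r m))
    (Feasible-∷-odd r (shape (A ++ B)) r-odd (numBars-feasible T′-bar))
  where
  T = A ++ replicate r m ∷ B
  m∉T′ = All-NoLabel⇒∉labels (++⁺ A∌m B∌m)
numBars-feasible (bar3 A B C (suc r₁) r₂ m _ odd _ _ A∌m B∌m C∌m T′-bar) =
  Feasible-resp (sym (numBars-addBar T (A ++ B ++ C) (r₁ + r₂) m∉T′ (labels-bar3 A B C (suc r₁) r₂ m)))
    (↭-sym (shape-bar3 A B C (suc r₁) r₂ m))
    (Feasible-∷-pair (suc r₁) r₂ (shape (A ++ B ++ C)) (Odd⇒isOdd odd) (numBars-feasible T′-bar))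
  where
  T = A ++ replicate (suc r₁) m ∷ B ++ replicate r₂ m ∷ C
  m∉T′ = All-NoLabel⇒∉labels (++⁺ A∌m (++⁺ B∌m C∌m))

minBarsOf≤numBars : ∀ {T} → IsBarTableau T → minBarsOf (shape T) ≤ numBars T
minBarsOf≤numBars T-bar with e≤n , o≤n , par ← numBars-feasible T-bar = minBars-least e≤n o≤n par

-- Construction

OddRowBoundaries : List ℕ → Set
OddRowBoundaries row =
  ∀ (xs ys : List ℕ) (a b : ℕ) → row ≡ xs ++ a ∷ b ∷ ys → a ≢ b → Odd (suc (length xs))

replicate-oddRowBoundaries : ∀ n m → OddRowBoundaries (replicate n m)
replicate-oddRowBoundaries n m xs ys a b eq a≢b
  with a≡m ∷ b≡m ∷ _ ← ++⁻ʳ xs (subst (All (_≡ m)) eq (replicate⁺ n refl)) =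
  ⊥-elim (a≢b (trans a≡m (sym b≡m)))

∷ʳ-oddRowBoundaries : ∀ {p} m → OddRowBoundaries p → Odd (length p) → OddRowBoundaries (p ∷ʳ m)
∷ʳ-oddRowBoundaries {p} m p-odd |p|-odd xs ys a b eq a≢b with initLast ys
... | [] = subst Odd (trans (cong length p≡) (trans (length-++ xs) (+-comm (length xs) 1))) |p|-odd
  where
  p≡ : p ≡ xs ∷ʳ a
  p≡ = ∷ʳ-injectiveˡ p (xs ∷ʳ a) (trans eq (sym (∷ʳ-++ xs a [ b ])))
... | ys′ ∷ʳ′ y = p-odd xs ys′ a b p≡ a≢b
  where
  p≡ : p ≡ xs ++ a ∷ b ∷ ys′
  p≡ = ∷ʳ-injectiveˡ p (xs ++ a ∷ b ∷ ys′) (trans eq (sym (++-assoc xs (a ∷ b ∷ ys′) [ y ])))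

Linked-delete : ∀ {R : Rel X ℓ} → Transitive R → ∀ B {y C} → Linked R (B ++ y ∷ C) → Linked R (B ++ C)
Linked-delete R-trans []                       l           = Linked.tail l
Linked-delete R-trans (b ∷ [])     {C = []}    _           = [-]
Linked-delete R-trans (b ∷ [])     {C = c ∷ C} (r ∷ s ∷ l) = R-trans r s ∷ l
Linked-delete R-trans (b ∷ b′ ∷ B)             (r ∷ l)     = r ∷ Linked-delete R-trans (b′ ∷ B) l

StrictPartition-delete : ∀ B {y C} → StrictPartition (B ++ y ∷ C) → StrictPartition (B ++ C)
StrictPartition-delete B (pos , sorted) =
  ++⁺ (++⁻ˡ B pos) (All.tail (++⁻ʳ B pos)) , Linked-delete (λ r s → <-trans s r) B sorted

StrictPartition-pred : isOdd x ≡ true → All (λ z → isOdd z ≡ false) λs →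
                       StrictPartition (suc x ∷ λs) → StrictPartition (x ∷ λs)
StrictPartition-pred x-odd []           (_ ∷ pos , _)              = isOdd⇒0< x-odd ∷ pos , [-]
StrictPartition-pred {x} {y ∷ _} x-odd (y-even ∷ _) (_ ∷ pos , y<1+x ∷ sorted) =
  isOdd⇒0< x-odd ∷ pos , ≤∧≢⇒< (s≤s⁻¹ y<1+x) y≢x ∷ sorted
  where
  y≢x : y ≢ x
  y≢x refl with () ← trans (sym y-even) x-odd

sum-delete : ∀ B {y C} → sum (B ++ C) ≤ sum (B ++ y ∷ C)
sum-delete []      {y} = m≤n+m _ y
sum-delete (b ∷ B)     = +-monoʳ-≤ b (sum-delete B)

sameParity⊎partner : ∀ b λs →
  All (λ z → isOdd z ≡ b) λs ⊎ ∃₂ λ B C → ∃ λ y → λs ≡ B ++ y ∷ C × isOdd y ≢ b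
sameParity⊎partner b λs with all? (λ z → isOdd z Bool.≟ b) λs
... | yes same = inj₁ same
... | no ¬same
  with y , y∈λs , y≢b ← find (¬All⇒Any¬ (λ z → isOdd z Bool.≟ b) λs ¬same)
  with B , C , refl ← ∈-∃++ y∈λs = inj₂ (B , C , y , refl , y≢b)

record OptimalTableau (λs : List ℕ) : Set where
  constructor optimal
  field
    tableau         : Tableau
    shape≡          : shape tableau ≡ λs
    labels-positive : All (All (0 <_)) tableau
    isBarTableau    : IsBarTableau tableau
    oddBoundaries   : All OddRowBoundaries tableau
    numBars≡        : numBars tableau ≡ minBarsOf λs

optimal-odd : isOdd (suc x) ≡ true → All (λ z → isOdd z ≡ true) λs →
              OptimalTableau λs → OptimalTableau (suc x ∷ λs)
optimal-odd {x} x-odd odds (optimal T′ refl pos bar oddB nb) =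
  optimal T shape-T (replicate⁺ (suc x) (s≤s z≤n) ∷ pos) bar-T
    (replicate-oddRowBoundaries (suc x) m ∷ oddB) nb-T
  where
  m = freshLabel T′
  T = replicate (suc x) m ∷ T′
  shape-T : shape T ≡ suc x ∷ shape T′
  shape-T = cong (_∷ shape T′) (length-replicate (suc x))
  bar-T : IsBarTableau T
  bar-T = bar2 [] T′ (suc x) m (freshLabel-max T T′ x ↭-refl) (isOdd⇒Odd (suc x) x-odd)
    [] (freshLabel-NoLabel T′) bar
  nb-T : numBars T ≡ minBarsOf (suc x ∷ shape T′)
  nb-T = trans (freshLabel-numBars T T′ x ↭-refl)
    (trans (cong suc nb) (sym (minBarsOf-∷-odd (suc x) (shape T′) x-odd odds)))

optimal-pair : ∀ B C → isOdd (suc x + y) ≡ true → 0 < y →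
               OptimalTableau (B ++ C) → OptimalTableau (suc x ∷ B ++ y ∷ C)
optimal-pair {x} {y} B C odd y>0 (optimal T′ sh pos bar oddB nb)
  with BT , CT , refl , refl , refl ← map-++⁻ length T′ {B} {C} sh =
  optimal T shape-T pos-T bar-T oddB-T nb-T
  where
  m = freshLabel (BT ++ CT)
  T = replicate (suc x) m ∷ BT ++ replicate y m ∷ CT
  labels-T : labels T ↭ replicate (suc x + y) m ++ labels (BT ++ CT)
  labels-T = labels-bar3 [] BT CT (suc x) y m
  fresh : All (NoLabel m) (BT ++ CT)
  fresh = freshLabel-NoLabel (BT ++ CT)
  shape-T : shape T ≡ suc x ∷ shape BT ++ y ∷ shape CT
  shape-T = cong₂ _∷_ (length-replicate (suc x))
    (trans (map-++ length BT _) (cong (λ ℓ → shape BT ++ ℓ ∷ shape CT) (length-replicate y)))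
  pos-T : All (All (0 <_)) T
  pos-T = replicate⁺ (suc x) (s≤s z≤n) ∷ ++⁺ (++⁻ˡ BT pos) (replicate⁺ y (s≤s z≤n) ∷ ++⁻ʳ BT pos)
  bar-T : IsBarTableau T
  bar-T = bar3 [] BT CT (suc x) y m (freshLabel-max T (BT ++ CT) (x + y) labels-T) (isOdd⇒Odd _ odd)
    (s≤s z≤n) y>0 [] (++⁻ˡ BT fresh) (++⁻ʳ BT fresh) bar
  oddB-T : All OddRowBoundaries T
  oddB-T = replicate-oddRowBoundaries (suc x) m
    ∷ ++⁺ (++⁻ˡ BT oddB) (replicate-oddRowBoundaries y m ∷ ++⁻ʳ BT oddB)
  nb-T : numBars T ≡ minBarsOf (suc x ∷ shape BT ++ y ∷ shape CT)
  nb-T = begin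
    numBars T                                     ≡⟨ freshLabel-numBars T (BT ++ CT) (x + y) labels-T ⟩
    suc (numBars (BT ++ CT))                      ≡⟨ cong suc nb ⟩
    suc (minBarsOf (shape BT ++ shape CT))        ≡⟨ minBarsOf-∷-pair (suc x) y _ odd ⟨
    minBarsOf (suc x ∷ y ∷ shape BT ++ shape CT)  ≡⟨ minBarsOf-↭ (↭-prep (suc x) (shift y (shape BT) (shape CT))) ⟨
    minBarsOf (suc x ∷ shape BT ++ y ∷ shape CT)  ∎
    where open ≡-Reasoning

optimal-even : isOdd x ≡ true → All (λ z → isOdd z ≡ false) λs → Linked _>_ (x ∷ λs) →
               OptimalTableau (x ∷ λs) → OptimalTableau (suc x ∷ λs)
optimal-even _ _ _ (optimal [] () _ _ _ _)
optimal-even x-odd evens sorted (optimal (p ∷ B) refl (p-pos ∷ B-pos) bar (p-odd ∷ B-odd) nb) =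
  optimal T shape-T (++⁺ p-pos (s≤s z≤n ∷ []) ∷ B-pos) bar-T
    (∷ʳ-oddRowBoundaries m p-odd (isOdd⇒Odd _ x-odd) ∷ B-odd) nb-T
  where
  m = freshLabel (p ∷ B)
  T = (p ∷ʳ m) ∷ B
  labels-T : labels T ↭ replicate 1 m ++ labels (p ∷ B)
  labels-T = ↭-trans (↭-reflexive (∷ʳ-++ p m (labels B))) (shift m p (labels B))
  fresh : All (NoLabel m) (p ∷ B)
  fresh = freshLabel-NoLabel (p ∷ B)
  |p|∉B : length p ∉ shape B
  |p|∉B |p|∈B with () ← trans (sym x-odd) (All.lookup evens |p|∈B)
  shape-T : shape T ≡ suc (length p) ∷ shape B
  shape-T = cong (_∷ shape B) (trans (length-++ p) (+-comm (length p) 1))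
  bar-T : IsBarTableau T
  bar-T = bar1 [] B p 1 m (freshLabel-max T (p ∷ B) 0 labels-T) (0 , refl) (isOdd⇒0< x-odd)
    (All.head fresh) [] (All.tail fresh) |p|∉B (subst IsBarTableau (sym (insertRow-longest p B sorted)) bar)
  nb-T : numBars T ≡ minBarsOf (suc (length p) ∷ shape B)
  nb-T = trans (freshLabel-numBars T (p ∷ B) 0 labels-T)
    (trans (cong suc nb) (sym (minBarsOf-suc (length p) (shape B) x-odd evens)))

-- Recursion on the sum of the parts, since the even case keeps their number.
optimalTableau : ∀ λs → StrictPartition λs → Acc _<_ (sum λs) → OptimalTableau λs
optimalTableau []           _                _         = optimal [] refl [] empty [] refl
optimalTableau (zero ∷ _)   (() ∷ _ , _)     _
optimalTableau (suc x ∷ λs) sp@(_ ∷ pos , _) (acc rec) with sameParity⊎partner (isOdd (suc x)) λs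
... | inj₂ (B , C , y , refl , y≢x) =
  optimal-pair B C (isOdd-+-≢ (suc x) y (≢-sym y≢x)) (All.head (++⁻ʳ B pos))
    (optimalTableau (B ++ C) (StrictPartition-delete B (StrictPartition-delete [] sp))
      (rec (s≤s (≤-trans (sum-delete B) (m≤n+m _ x)))))
... | inj₁ same with isOdd (suc x) in parity
...   | true  = optimal-odd parity same
  (optimalTableau λs (StrictPartition-delete [] sp) (rec (s≤s (m≤n+m _ x))))
...   | false = optimal-even x-odd same (proj₂ sp′) (optimalTableau (x ∷ λs) sp′ (rec ≤-refl))
  where
  x-odd = not-injective {isOdd x} {true} parity
  sp′ = StrictPartition-pred x-odd same sp

mainTheorem2 : (λs : List ℕ) → StrictPartition λs →
    ∃ λ T → MinimalBarTableau λs T × OddBoundaries T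
mainTheorem2 λs sp =
  tableau , ((shape≡ , labels-positive , isBarTableau) , minimal) , λ _ → All.lookup oddBoundaries
  where
  open OptimalTableau (optimalTableau λs sp (<-wellFounded (sum λs)))
  minimal : ∀ T′ → BarTableauOfShape λs T′ → numBars tableau ≤ numBars T′
  minimal T′ (shape≡′ , _ , T′-bar) = ≤-trans (≤-reflexive numBars≡)
    (subst (λ μs → minBarsOf μs ≤ numBars T′) shape≡′ (minBarsOf≤numBars T′-bar))
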